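{- Let $A$ and $B$ be finite subsets of an abelian group. If for some real $\varepsilon>0$ we have $|B|\le(1-\varepsilon)|A|$ and $|B-B|\ge\varepsilon^{ -1}|A|$, then $|A+B|\ge |A|+|B|$, and moreover $|A\stackrel{\tau}{+}B|\ge |A|+|B|-2$ for every mapping $\tau\colon B\to A$.
   Context: For subsets $A,B$ of an abelian group, $A+B=\{a+b: a\in A, b\in B\}$ and $B-B=\{b'-b'': b',b''\in B\}$. For a mapping $\tau\colon B\to A$, the restricted sumset is $A\stackrel{\tau}{+}B:=\{a+b: a\in A,\ b\in B,\ a\ne\tau(b)\}$.
   Formalization: The parameter ε ranges over the positive rationals instead of the positive reals. -}

module Defs where

open import Level using (_⊔_)
open import Algebra.Bundles using (AbelianGroup)
open import Data.Nat using (ℕ)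
open import Data.Fin using (Fin)
open import Data.List using (List; length; lookup)
open import Data.Product using (∃₂; _×_)
open import Relation.Nullary using (¬_)
open import Relation.Binary.PropositionalEquality using (_≡_)
import Data.Integer as ℤ
open import Data.Rational using (ℚ; _/_)
import Data.List.Relation.Unary.Unique.Setoid as UniqueS
import Data.List.Membership.Setoid as MemS

toℚ : ℕ → ℚ
toℚ n = ℤ.+ n / 1

module _ {c ℓ} (G : AbelianGroup c ℓ) where
  open AbelianGroup G renaming (Carrier to X)

  -- A finite subset of G: a duplicate-free list (w.r.t. the group's equality);
  -- its cardinality is the length of the list.
  IsFinSet : List X → Set (c ⊔ ℓ)
  IsFinSet xs = UniqueS.Unique setoid xs

  InSum : List X → List X → X → Set ℓ
  InSum A B x = ∃₂ λ (i : Fin (length A)) (j : Fin (length B)) →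
    x ≈ (lookup A i ∙ lookup B j)

  InDiff : List X → X → Set ℓ
  InDiff B x = ∃₂ λ (j k : Fin (length B)) → x ≈ (lookup B j ∙ (lookup B k ⁻¹))

  -- membership in the restricted sumset A +^τ B, where τ : B → A is given
  -- on indices (elements of the duplicate-free lists)
  InRestrSum : (A B : List X) → (Fin (length B) → Fin (length A)) → X → Set ℓ
  InRestrSum A B τ x = ∃₂ λ (i : Fin (length A)) (j : Fin (length B)) →
    ¬ (i ≡ τ j) × x ≈ (lookup A i ∙ lookup B j)

  Enumerates : List X → (X → Set ℓ) → Set (c ⊔ ℓ)
  Enumerates S P = IsFinSet S × (∀ x → (MemS._∈_ setoid x S → P x) × (P x → MemS._∈_ setoid x S))

module Submission where

-- Let n = |A|, m = |B|, N = |B - B|.  The two rational hypotheses say exactly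
-- that m ≤ n and, writing t = n - m, that n² ≤ N·t (module Density).
--
-- Fix, for every difference d_k ∈ B - B, a representation d_k = b_j - b_{j'}.
-- Call a row i' an overlap of d_k when a_{i'} + b_j = a_i + b_{j'} for some i,
-- i.e. when a_{i'} + d_k ∈ A.  For a fixed row i' the map k ↦ a_{i'} + d_k is
-- injective into A, so summing over k the number of overlaps is at most n²
-- (double counting).  Averaging over the N differences yields some d_k with at
-- most t overlaps.  The two translates A + b_{j'} and A + b_j then meet in at
-- most t points, so |A + B| ≥ 2n - t = n + m.
--
-- The restricted sumset is handled simultaneously: we work with an arbitrary
-- decidable set of forbidden pairs (i, j) containing at most c rows per
-- column, and the same argument gives |S| ≥ n + m - 2c.  The sumset is the
-- case c = 0, and a map τ : B → A forbids one row per column (c = 1).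

open import Algebra.Bundles using (AbelianGroup)
open import Relation.Binary.Bundles using (Setoid)

module Counting where

  open import Level using (Level)
  open import Data.Bool.Base using (if_then_else_)
  open import Data.Nat.Base using (ℕ; zero; suc; _+_; _*_; _≤_; z≤n; s≤s)
  open import Data.Nat.Properties
    using (+-0-commutativeMonoid; +-mono-≤; +-comm; +-identityʳ; *-identityʳ; *-zeroʳ; *-suc;
           +-cancelˡ-≤; n≤0⇒n≡0; ≰⇒>; _≤?_; module ≤-Reasoning)
  open import Data.Empty using (⊥-elim)
  open import Data.Fin.Base using (Fin; zero; suc)
  open import Data.Fin.Properties using (_≟_; any?)
  open import Data.List.Base using (filter; tabulate; allFin; length)
  open import Data.Product.Base using (∃; _,_)
  open import Data.Sum.Base using (_⊎_; inj₁; inj₂)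
  open import Function.Base using (_∘_)
  open import Relation.Nullary using (Dec; yes; no; does; ¬_)
  open import Relation.Nullary.Decidable using (¬?; _⊎-dec_)
  open import Relation.Unary using (Pred; Decidable)
  open import Relation.Binary.PropositionalEquality using (_≡_; refl; cong; sym; trans; module ≡-Reasoning)
  open import Algebra.Properties.CommutativeMonoid.Sum +-0-commutativeMonoid public
    using (sum; sum-syntax; ∑-comm; ∑-distrib-+; sum-cong-≗)

  private variable
    p q : Level
    n : ℕ

  sum-mono : {f g : Fin n → ℕ} → (∀ i → f i ≤ g i) → sum f ≤ sum g
  sum-mono {zero}  f≤g = z≤n
  sum-mono {suc n} f≤g = +-mono-≤ (f≤g zero) (sum-mono (f≤g ∘ suc))

  sum-const : ∀ n k → ∑[ i < n ] k ≡ n * k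
  sum-const zero    k = refl
  sum-const (suc n) k = cong (k +_) (sum-const n k)

  indicator : {P : Set p} → Dec P → ℕ
  indicator d = if does d then 1 else 0

  count : {P : Pred (Fin n) p} → Decidable P → ℕ
  count {n = n} P? = ∑[ i < n ] indicator (P? i)

  count-filter : {P : Pred (Fin n) p} (P? : Decidable P) → length (filter P? (allFin n)) ≡ count P?
  count-filter {n = n} P? = filter-tabulate n (λ i → i)
    where
    filter-tabulate : ∀ k (g : Fin k → Fin n) →
      length (filter P? (tabulate g)) ≡ ∑[ i < k ] indicator (P? (g i))
    filter-tabulate zero    g = refl
    filter-tabulate (suc k) g with P? (g zero)
    ... | yes _ = cong suc (filter-tabulate k (g ∘ suc))
    ... | no  _ = filter-tabulate k (g ∘ suc)

  count-empty : {P : Pred (Fin n) p} (P? : Decidable P) → (∀ i → ¬ P i) → count P? ≡ 0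
  count-empty {n = n} P? none = begin
    ∑[ i < n ] indicator (P? i)  ≡⟨ sum-cong-≗ zero-at ⟩
    ∑[ i < n ] 0                 ≡⟨ sum-const n 0 ⟩
    n * 0                        ≡⟨ *-zeroʳ n ⟩
    0                            ∎
    where
    open ≡-Reasoning
    zero-at : ∀ i → indicator (P? i) ≡ 0
    zero-at i with P? i
    ... | yes Pi = ⊥-elim (none i Pi)
    ... | no  _  = refl

  count-complement : {P : Pred (Fin n) p} (P? : Decidable P) → count P? + count (¬? ∘ P?) ≡ n
  count-complement {n = n} P? = begin
    count P? + count (¬? ∘ P?)                              ≡⟨ sym (∑-distrib-+ (indicator ∘ P?) (indicator ∘ ¬? ∘ P?)) ⟩
    ∑[ i < n ] (indicator (P? i) + indicator (¬? (P? i)))   ≡⟨ sum-cong-≗ (exactly-one ∘ P?) ⟩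
    ∑[ i < n ] 1                                            ≡⟨ sum-const n 1 ⟩
    n * 1                                                   ≡⟨ *-identityʳ n ⟩
    n                                                       ∎
    where
    open ≡-Reasoning
    exactly-one : ∀ {P : Set p} (d : Dec P) → indicator d + indicator (¬? d) ≡ 1
    exactly-one (yes _) = refl
    exactly-one (no  _) = refl

  count-⊎ : {P : Pred (Fin n) p} {Q : Pred (Fin n) q} (P? : Decidable P) (Q? : Decidable Q) →
            count (λ i → P? i ⊎-dec Q? i) ≤ count P? + count Q?
  count-⊎ {n = n} P? Q? = begin
    count (λ i → P? i ⊎-dec Q? i)                     ≤⟨ sum-mono (λ i → union-bound (P? i) (Q? i)) ⟩
    ∑[ i < n ] (indicator (P? i) + indicator (Q? i))  ≡⟨ ∑-distrib-+ (indicator ∘ P?) (indicator ∘ Q?) ⟩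
    count P? + count Q?                               ∎
    where
    open ≤-Reasoning
    union-bound : ∀ {P : Set p} {Q : Set q} (d : Dec P) (e : Dec Q) →
                  indicator (d ⊎-dec e) ≤ indicator d + indicator e
    union-bound (yes _) _       = s≤s z≤n
    union-bound (no _)  (yes _) = s≤s z≤n
    union-bound (no _)  (no _)  = z≤n

  count-≟ : (x : Fin n) → count (_≟ x) ≡ 1
  count-≟ {suc n} zero    = cong suc (trans (sum-const n 0) (*-zeroʳ n))
  count-≟ {suc n} (suc x) = count-≟ x

  averaging : ∀ {N} (f : Fin N → ℕ) t → sum f ≤ N * t → (∃ λ k → f k ≤ t) ⊎ N ≡ 0
  averaging {N} f t Σf≤Nt with any? (λ k → f k ≤? t)
  ... | yes small = inj₁ small
  ... | no  none  = inj₂ (n≤0⇒n≡0 (+-cancelˡ-≤ (N * t) N 0 (begin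
    N * t + N         ≡⟨ +-comm (N * t) N ⟩
    N + N * t         ≡⟨ sym (*-suc N t) ⟩
    N * suc t         ≡⟨ sym (sum-const N (suc t)) ⟩
    ∑[ k < N ] suc t  ≤⟨ sum-mono (λ k → ≰⇒> (λ fk≤t → none (k , fk≤t))) ⟩
    sum f             ≤⟨ Σf≤Nt ⟩
    N * t             ≡⟨ sym (+-identityʳ (N * t)) ⟩
    N * t + 0         ∎)))
    where open ≤-Reasoning

module UniqueLists {a ℓ} (S : Setoid a ℓ) where

  open import Level using (Level)
  open import Data.Nat.Base using (ℕ; _≤_)
  open import Data.Fin.Base using (Fin; zero; suc)
  open import Data.Fin.Properties using (injective⇒≤) renaming (_≟_ to _≟ᶠ_)
  open import Data.List.Base using (List; length; lookup; map; filter; allFin)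
  open import Data.List.Properties using (length-map)
  open import Data.List.Relation.Unary.AllPairs using (_∷_)
  import Data.List.Relation.Unary.All as All
  import Data.List.Relation.Unary.Any as Any
  open import Data.List.Relation.Unary.Any.Properties using (lookup-index)
  open import Data.List.Membership.Setoid S using (_∈_)
  open import Data.List.Membership.Setoid.Properties using (index-injective; ∈-lookup; ∈-map⁻)
  open import Data.List.Membership.Propositional.Properties as ∈ₚ using (∈-filter⁻)
  open import Data.List.Relation.Unary.Unique.Setoid S using (Unique)
  import Data.List.Relation.Unary.Unique.Setoid.Properties as Unique
  open import Data.List.Relation.Unary.Unique.Propositional.Properties using (allFin⁺)
  open import Data.Product.Base using (∃; _×_; _,_)
  open import Data.Empty using (⊥-elim)
  open import Relation.Nullary using (Dec; yes; no)
  open import Relation.Unary using (Pred; Decidable)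
  open import Relation.Binary.PropositionalEquality as ≡ using (_≡_; refl; cong)
  open Setoid S using (_≈_; sym; trans; reflexive) renaming (Carrier to X)
  open Counting using (count; count-filter)

  private variable
    p : Level
    r : ℕ

  lookup-injective : ∀ {xs} → Unique xs → ∀ i j → lookup xs i ≈ lookup xs j → i ≡ j
  lookup-injective (_  ∷ _) zero    zero    _ = refl
  lookup-injective (x≉ ∷ _) zero    (suc j) e = ⊥-elim (All.lookup x≉ (∈ₚ.∈-lookup j) e)
  lookup-injective (x≉ ∷ _) (suc i) zero    e = ⊥-elim (All.lookup x≉ (∈ₚ.∈-lookup i) (sym e))
  lookup-injective (_  ∷ u) (suc i) (suc j) e = cong suc (lookup-injective u i j e)

  unique-⊆⇒length-≤ : ∀ {xs ys} → Unique xs → (∀ {x} → x ∈ xs → x ∈ ys) → length xs ≤ length ys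
  unique-⊆⇒length-≤ {xs} {ys} xs! xs⊆ys = injective⇒≤ position-injective
    where
    position : Fin (length xs) → Fin (length ys)
    position i = Any.index (xs⊆ys (∈-lookup S xs i))
    position-injective : ∀ {i j} → position i ≡ position j → i ≡ j
    position-injective {i} {j} e =
      lookup-injective xs! i j (index-injective S (xs⊆ys (∈-lookup S xs i)) (xs⊆ys (∈-lookup S xs j)) e)

  -- Equality between two members of a duplicate-free list is decidable:
  -- compare their positions.
  ≈-decidable-in : ∀ {ys x y} → Unique ys → x ∈ ys → y ∈ ys → Dec (x ≈ y)
  ≈-decidable-in {ys} ys! x∈ y∈ with Any.index x∈ ≟ᶠ Any.index y∈
  ... | yes same = yes (trans (lookup-index x∈) (trans (reflexive (cong (lookup ys) same)) (sym (lookup-index y∈))))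
  ... | no  diff = no λ x≈y → diff (lookup-injective ys! _ _
                    (trans (sym (lookup-index x∈)) (trans x≈y (lookup-index y∈))))

  image : (Fin r → X) → {P : Pred (Fin r) p} → Decidable P → List X
  image {r = r} f P? = map f (filter P? (allFin r))

  image-length : (f : Fin r → X) {P : Pred (Fin r) p} (P? : Decidable P) → length (image f P?) ≡ count P?
  image-length {r = r} f P? = ≡.trans (length-map f (filter P? (allFin r))) (count-filter P?)

  image-unique : {f : Fin r → X} → (∀ {i j} → f i ≈ f j → i ≡ j) →
                 {P : Pred (Fin r) p} (P? : Decidable P) → Unique (image f P?)
  image-unique {r = r} f-inj P? =
    Unique.map⁺ (≡.setoid (Fin r)) S f-inj (Unique.filter⁺ (≡.setoid (Fin r)) P? (allFin⁺ r))

  image-∈ : {f : Fin r → X} {P : Pred (Fin r) p} (P? : Decidable P) →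
            ∀ {x} → x ∈ image f P? → ∃ λ i → P i × x ≈ f i
  image-∈ P? x∈ with ∈-map⁻ (≡.setoid _) S x∈
  ... | i , i∈ , x≈fi with ∈-filter⁻ P? {xs = allFin _} i∈
  ... | _ , Pi = i , Pi , x≈fi

module Density where

  open import Defs using (toℚ)
  open import Data.Nat.Base as ℕ using (ℕ)
  open import Data.Nat.Properties using (m≤n⇒∃[o]m+o≡n)
  import Data.Nat.Coprimality as Coprime
  import Data.Integer.Base as ℤ
  import Data.Integer.Properties as ℤ
  open import Data.Rational.Base
  open import Data.Rational.Properties
  open import Data.Rational.Solver using (module +-*-Solver)
  open import Data.Product.Base using (proj₁; proj₂)
  open import Relation.Binary.PropositionalEquality

  toℚ-canonical : ∀ n → toℚ n ≡ mkℚ (ℤ.+ n) 0 (Coprime.sym (Coprime.1-coprimeTo n))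
  toℚ-canonical n = normalize-coprime (Coprime.sym (Coprime.1-coprimeTo n))

  toℚ-+ : ∀ a b → toℚ a + toℚ b ≡ toℚ (a ℕ.+ b)
  toℚ-+ a b rewrite toℚ-canonical a | toℚ-canonical b =
    cong (_/ 1) (trans (cong₂ ℤ._+_ (ℤ.*-identityʳ (ℤ.+ a)) (ℤ.*-identityʳ (ℤ.+ b))) (sym (ℤ.pos-+ a b)))

  toℚ-* : ∀ a b → toℚ a * toℚ b ≡ toℚ (a ℕ.* b)
  toℚ-* a b rewrite toℚ-canonical a | toℚ-canonical b = cong (_/ 1) (sym (ℤ.pos-* a b))

  toℚ-cancel-≤ : ∀ a b → toℚ a ≤ toℚ b → a ℕ.≤ b
  toℚ-cancel-≤ a b a≤b rewrite toℚ-canonical a | toℚ-canonical b with a≤b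
  ... | *≤* a≤b′ = ℤ.drop‿+≤+ (subst₂ ℤ._≤_ (ℤ.*-identityʳ (ℤ.+ a)) (ℤ.*-identityʳ (ℤ.+ b)) a≤b′)

  toℚ-nonNeg : ∀ a → NonNegative (toℚ a)
  toℚ-nonNeg a rewrite toℚ-canonical a = _

  +-cancelˡ-≤ : ∀ p {q r} → p + q ≤ p + r → q ≤ r
  +-cancelˡ-≤ p {q} {r} le = subst₂ _≤_ (cancel q) (cancel r) (+-monoʳ-≤ (- p) le)
    where
    open +-*-Solver
    cancel : ∀ x → (- p) + (p + x) ≡ x
    cancel x = solve 2 (λ p x → (:- p) :+ (p :+ x) := x) refl p x

  module FromHypotheses (n m N : ℕ) (ε : ℚ) .{{_ : Positive ε}}
           (m≤[1-ε]n : toℚ m ≤ (1ℚ - ε) * toℚ n)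
           (n/ε≤N : (1/ ε) {{pos⇒nonZero ε}} * toℚ n ≤ toℚ N) where

    private
      instance
        ε-nonZero : NonZero ε
        ε-nonZero = pos⇒nonZero ε
        ε-nonNeg : NonNegative ε
        ε-nonNeg = pos⇒nonNeg ε
        n-nonNeg : NonNegative (toℚ n)
        n-nonNeg = toℚ-nonNeg n
        εn-nonNeg : NonNegative (ε * toℚ n)
        εn-nonNeg = nonNeg*nonNeg⇒nonNeg ε (toℚ n)
        N-nonNeg : NonNegative (toℚ N)
        N-nonNeg = toℚ-nonNeg N

      open ≤-Reasoning

      split : (1ℚ - ε) * toℚ n + ε * toℚ n ≡ toℚ n
      split = solve 2 (λ e x → (con 1ℚ :- e) :* x :+ e :* x := x) refl ε (toℚ n)
        where open +-*-Solver

      m≤n : m ℕ.≤ n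
      m≤n = toℚ-cancel-≤ m n (begin
        toℚ m                                ≤⟨ m≤[1-ε]n ⟩
        (1ℚ - ε) * toℚ n                     ≡⟨ sym (+-identityʳ _) ⟩
        (1ℚ - ε) * toℚ n + 0ℚ                ≤⟨ +-monoʳ-≤ ((1ℚ - ε) * toℚ n) (nonNegative⁻¹ (ε * toℚ n)) ⟩
        (1ℚ - ε) * toℚ n + ε * toℚ n         ≡⟨ split ⟩
        toℚ n                                ∎)

    gap : ℕ
    gap = proj₁ (m≤n⇒∃[o]m+o≡n m≤n)

    n≡m+gap : n ≡ m ℕ.+ gap
    n≡m+gap = sym (proj₂ (m≤n⇒∃[o]m+o≡n m≤n))

    εn≤gap : ε * toℚ n ≤ toℚ gap
    εn≤gap = +-cancelˡ-≤ (toℚ m) (begin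
      toℚ m + ε * toℚ n             ≤⟨ +-monoˡ-≤ (ε * toℚ n) m≤[1-ε]n ⟩
      (1ℚ - ε) * toℚ n + ε * toℚ n  ≡⟨ split ⟩
      toℚ n                         ≡⟨ cong toℚ n≡m+gap ⟩
      toℚ (m ℕ.+ gap)               ≡⟨ sym (toℚ-+ m gap) ⟩
      toℚ m + toℚ gap               ∎)

    -- |A|² = (ε⁻¹|A|)(ε|A|) ≤ |B - B| · gap.
    square≤N*gap : n ℕ.* n ℕ.≤ N ℕ.* gap
    square≤N*gap = toℚ-cancel-≤ (n ℕ.* n) (N ℕ.* gap) (begin
      toℚ (n ℕ.* n)                    ≡⟨ sym (toℚ-* n n) ⟩
      toℚ n * toℚ n                    ≡⟨ sym (*-identityˡ _) ⟩
      1ℚ * (toℚ n * toℚ n)             ≡⟨ cong (_* (toℚ n * toℚ n)) (sym (*-inverseˡ ε)) ⟩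
      ((1/ ε) * ε) * (toℚ n * toℚ n)   ≡⟨ regroup ⟩
      ((1/ ε) * toℚ n) * (ε * toℚ n)   ≤⟨ *-monoʳ-≤-nonNeg (ε * toℚ n) n/ε≤N ⟩
      toℚ N * (ε * toℚ n)              ≤⟨ *-monoˡ-≤-nonNeg (toℚ N) εn≤gap ⟩
      toℚ N * toℚ gap                  ≡⟨ toℚ-* N gap ⟩
      toℚ (N ℕ.* gap)                  ∎)
      where
      open +-*-Solver
      regroup : ((1/ ε) * ε) * (toℚ n * toℚ n) ≡ ((1/ ε) * toℚ n) * (ε * toℚ n)
      regroup = solve 3 (λ i e x → (i :* e) :* (x :* x) := (i :* x) :* (e :* x)) refl (1/ ε) ε (toℚ n)

module Sumsets {c ℓ} (G : AbelianGroup c ℓ) where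

  open import Data.Nat.Base using (ℕ; _+_; _*_; _≤_; z≤n)
  open import Data.Nat.Properties
    using (+-assoc; +-mono-≤; +-monoʳ-≤; +-monoˡ-≤; +-cancelʳ-≤; ≤-trans; m+n≡0⇒m≡0; module ≤-Reasoning)
  open import Data.Nat.Solver using (module +-*-Solver)
  open import Data.Fin.Base using (Fin)
  open import Data.Fin.Properties using (any?)
  open import Data.List.Base using (List; length; lookup; _++_)
  open import Data.List.Properties using (length-++)
  open import Data.List.Membership.Setoid.Properties using (∈-lookup; ∈-resp-≈; ∈-++⁻)
  import Data.List.Relation.Unary.Unique.Setoid.Properties as Unique
  open import Data.List.Relation.Binary.Disjoint.Setoid using (Disjoint)
  open import Data.Product.Base using (∃; _×_; _,_; proj₁; proj₂)
  open import Data.Sum.Base using (_⊎_; inj₁; inj₂)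
  open import Function.Base using (_∘_)
  open import Relation.Nullary using (Dec; yes; no; ¬_)
  open import Relation.Nullary.Decidable using (¬?; _⊎-dec_; map′)
  open import Relation.Unary using (Decidable)
  open import Relation.Binary.PropositionalEquality as ≡ using (_≡_)
  open import Defs
  open AbelianGroup G renaming (Carrier to X)
  import Relation.Binary.Reasoning.Setoid
  open import Algebra.Properties.Group group using (∙-cancelˡ; ∙-cancelʳ; //-rightDividesʳ)
  module ≈-Reasoning = Relation.Binary.Reasoning.Setoid setoid
  open import Data.List.Membership.Setoid setoid using (_∈_)
  open import Data.List.Relation.Unary.Unique.Setoid setoid using (Unique)
  open Counting
  open UniqueLists setoid

  shift : ∀ {w x y z} → w ∙ z ≈ x ∙ y → x ∙ (y ∙ z ⁻¹) ≈ w
  shift {w} {x} {y} {z} e = begin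
    x ∙ (y ∙ z ⁻¹)  ≈⟨ sym (assoc x y (z ⁻¹)) ⟩
    (x ∙ y) ∙ z ⁻¹  ≈⟨ ∙-congʳ (sym e) ⟩
    (w ∙ z) ∙ z ⁻¹  ≈⟨ //-rightDividesʳ z w ⟩
    w               ∎
    where open ≈-Reasoning

  module _ (A B : List X) (A! : IsFinSet G A)
           (F : Fin (length A) → Fin (length B) → Set) (F? : ∀ i j → Dec (F i j))
           (S : List X) (S! : IsFinSet G S)
           (allowed∈S : ∀ i j → ¬ F i j → lookup A i ∙ lookup B j ∈ S) where

    private
      n m : ℕ
      n = length A
      m = length B
      a : Fin n → X
      a = lookup A
      b : Fin m → X
      b = lookup B

    forbidden? : (j : Fin m) → Decidable (λ i → F i j)
    forbidden? j i = F? i j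

    Overlap : Fin m → Fin m → Fin n → Set ℓ
    Overlap j k i' = ¬ F i' j × ∃ λ i → ¬ F i k × a i ∙ b k ≈ a i' ∙ b j

    -- Decidable because all sums involved lie in the duplicate-free list S.
    overlap? : ∀ j k → Decidable (Overlap j k)
    overlap? j k i' with F? i' j
    ... | yes f  = no (λ (¬f , _) → ¬f f)
    ... | no  ¬f = map′ (¬f ,_) proj₂ (any? partner?)
      where
      partner? : ∀ i → Dec (¬ F i k × a i ∙ b k ≈ a i' ∙ b j)
      partner? i with F? i k
      ... | yes f′  = no (λ (¬f′ , _) → ¬f′ f′)
      ... | no  ¬f′ = map′ (¬f′ ,_) proj₂ (≈-decidable-in S! (allowed∈S i k ¬f′) (allowed∈S i' j ¬f))

    -- Rows of column j which contribute no sum outside column k.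
    blocked? : ∀ j k → Decidable (λ i' → F i' j ⊎ Overlap j k i')
    blocked? j k i' = F? i' j ⊎-dec overlap? j k i'

    translate : ∀ {p} {P : Fin n → Set p} → Fin m → Decidable P → List X
    translate k = image (λ i → a i ∙ b k)

    translate-unique : ∀ k {p} {P : Fin n → Set p} (P? : Decidable P) → Unique (translate k P?)
    translate-unique k = image-unique (λ e → lookup-injective A! _ _ (∙-cancelʳ (b k) _ _ e))

    -- Two columns j, k contribute |S| ≥ (n - #forbidden_k) + (n - #blocked_{j,k}):
    -- the allowed translate of column k and the unblocked one of column j are
    -- disjoint subsets of S.
    two-columns : ∀ j k → n + n ≤ length S + (count (forbidden? k) + count (blocked? j k))
    two-columns j k = begin
      n + n                        ≡⟨ ≡.sym (≡.cong₂ _+_ (count-complement (forbidden? k)) (count-complement (blocked? j k))) ⟩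
      (fₖ + aₖ) + (bⱼ + uⱼ)        ≡⟨ rearrange fₖ aₖ bⱼ uⱼ ⟩
      (aₖ + uⱼ) + (fₖ + bⱼ)        ≤⟨ +-monoˡ-≤ (fₖ + bⱼ) (≡.subst (_≤ length S) length-L (unique-⊆⇒length-≤ L! L⊆S)) ⟩
      length S + (fₖ + bⱼ)         ∎
      where
      open ≤-Reasoning
      fₖ = count (forbidden? k)
      aₖ = count (¬? ∘ forbidden? k)
      bⱼ = count (blocked? j k)
      uⱼ = count (¬? ∘ blocked? j k)
      L₁ = translate k (¬? ∘ forbidden? k)
      L₂ = translate j (¬? ∘ blocked? j k)

      rearrange : ∀ w x y z → (w + x) + (y + z) ≡ (x + z) + (w + y)
      rearrange = solve 4 (λ w x y z → (w :+ x) :+ (y :+ z) := (x :+ z) :+ (w :+ y)) ≡.refl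
        where open +-*-Solver

      disjoint : Disjoint setoid L₁ L₂
      disjoint (v∈₁ , v∈₂) with image-∈ (¬? ∘ forbidden? k) v∈₁ | image-∈ (¬? ∘ blocked? j k) v∈₂
      ... | i , ¬f , v≈₁ | i' , unblocked , v≈₂ =
        unblocked (inj₂ (unblocked ∘ inj₁ , i , ¬f , trans (sym v≈₁) v≈₂))

      L! : Unique (L₁ ++ L₂)
      L! = Unique.++⁺ setoid (translate-unique k _) (translate-unique j _) disjoint

      L⊆S : ∀ {x} → x ∈ L₁ ++ L₂ → x ∈ S
      L⊆S x∈ with ∈-++⁻ setoid L₁ x∈
      ... | inj₁ x∈₁ with image-∈ (¬? ∘ forbidden? k) x∈₁
      ...   | i , ¬f , x≈ = ∈-resp-≈ setoid (sym x≈) (allowed∈S i k ¬f)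
      L⊆S x∈ | inj₂ x∈₂ with image-∈ (¬? ∘ blocked? j k) x∈₂
      ...   | i' , unblocked , x≈ = ∈-resp-≈ setoid (sym x≈) (allowed∈S i' j (unblocked ∘ inj₁))

      length-L : length (L₁ ++ L₂) ≡ aₖ + uⱼ
      length-L = ≡.trans (length-++ L₁)
                   (≡.cong₂ _+_ (image-length _ (¬? ∘ forbidden? k)) (image-length _ (¬? ∘ blocked? j k)))

    module _ (D : List X) (D-enum : Enumerates G D (InDiff G B)) where

      private
        N : ℕ
        N = length D
        d : Fin N → X
        d = lookup D

      representation : ∀ k → InDiff G B (d k)
      representation k = proj₁ (proj₂ D-enum (d k)) (∈-lookup setoid D k)

      left right : Fin N → Fin m
      left  k = proj₁ (representation k)
      right k = proj₁ (proj₂ (representation k))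

      d≈ : ∀ k → d k ≈ b (left k) ∙ b (right k) ⁻¹
      d≈ k = proj₂ (proj₂ (representation k))

      overlaps : Fin N → ℕ
      overlaps k = count (overlap? (left k) (right k))

      -- A fixed row i' overlaps for at most n differences: if it overlaps
      -- for d_k then a_{i'} + d_k ∈ A, and k ↦ a_{i'} + d_k is injective.
      overlap-row : ∀ i' → count (λ k → overlap? (left k) (right k) i') ≤ n
      overlap-row i' =
        ≡.subst (_≤ n) (image-length shifted P?) (unique-⊆⇒length-≤ (image-unique shifted-injective P?) shifted⊆A)
        where
        P? = λ k → overlap? (left k) (right k) i'
        shifted : Fin N → X
        shifted k = a i' ∙ d k
        shifted-injective : ∀ {k k′} → shifted k ≈ shifted k′ → k ≡ k′
        shifted-injective e = lookup-injective (proj₁ D-enum) _ _ (∙-cancelˡ (a i') _ _ e)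
        shifted⊆A : ∀ {x} → x ∈ image shifted P? → x ∈ A
        shifted⊆A x∈ with image-∈ P? x∈
        ... | k , (_ , i , _ , sums≈) , x≈ =
          ∈-resp-≈ setoid (sym (trans x≈ (trans (∙-congˡ (d≈ k)) (shift sums≈)))) (∈-lookup setoid A i)

      overlap-total : sum overlaps ≤ n * n
      overlap-total = begin
        sum overlaps                                                   ≡⟨ ∑-comm (λ k i' → indicator (overlap? (left k) (right k) i')) ⟩
        ∑[ i' < n ] count (λ k → overlap? (left k) (right k) i')      ≤⟨ sum-mono overlap-row ⟩
        ∑[ i' < n ] n                                                  ≡⟨ sum-const n n ⟩
        n * n                                                          ∎
        where open ≤-Reasoning

      module _ (c t : ℕ) (c-bound : ∀ j → count (forbidden? j) ≤ c) (n≡m+t : n ≡ m + t) where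

        -- A difference with at most t overlaps gives |S| ≥ 2n - t - 2c = n + m - 2c.
        few-overlaps⇒bound : ∀ k → overlaps k ≤ t → n + m ≤ length S + (c + c)
        few-overlaps⇒bound k few = +-cancelʳ-≤ t (n + m) (length S + (c + c)) (begin
          n + m + t                 ≡⟨ ≡.trans (+-assoc n m t) (≡.cong (n +_) (≡.sym n≡m+t)) ⟩
          n + n                     ≤⟨ two-columns (left k) (right k) ⟩
          length S + (count (forbidden? (right k)) + count (blocked? (left k) (right k)))
                                    ≤⟨ +-monoʳ-≤ (length S) (+-mono-≤ (c-bound (right k)) blocked≤) ⟩
          length S + (c + (c + t))  ≡⟨ regroup (length S) c t ⟩
          length S + (c + c) + t    ∎)
          where
          open ≤-Reasoning
          blocked≤ : count (blocked? (left k) (right k)) ≤ c + t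
          blocked≤ = ≤-trans (count-⊎ (forbidden? (left k)) (overlap? (left k) (right k)))
                             (+-mono-≤ (c-bound (left k)) few)
          regroup : ∀ s c t → s + (c + (c + t)) ≡ s + (c + c) + t
          regroup = solve 3 (λ s c t → s :+ (c :+ (c :+ t)) := s :+ (c :+ c) :+ t) ≡.refl
            where open +-*-Solver

        -- Without differences, n² ≤ 0 forces A and B to be empty.
        no-differences⇒bound : N ≡ 0 → n * n ≤ N * t → n + m ≤ length S + (c + c)
        no-differences⇒bound N≡0 n²≤Nt = ≡.subst (_≤ length S + (c + c)) (≡.sym (≡.cong₂ _+_ n≡0 m≡0)) z≤n
          where
          square-zero : ∀ x → x * x ≤ 0 → x ≡ 0
          square-zero 0 _ = ≡.refl
          n≡0 : n ≡ 0
          n≡0 = square-zero n (≡.subst (λ N → n * n ≤ N * t) N≡0 n²≤Nt)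
          m≡0 : m ≡ 0
          m≡0 = m+n≡0⇒m≡0 m (≡.trans (≡.sym n≡m+t) n≡0)

        restricted-sumset-bound : n * n ≤ N * t → n + m ≤ length S + (c + c)
        restricted-sumset-bound n²≤Nt with averaging overlaps t (≤-trans overlap-total n²≤Nt)
        ... | inj₁ (k , few) = few-overlaps⇒bound k few
        ... | inj₂ N≡0       = no-differences⇒bound N≡0 n²≤Nt

open import Defs
open import Data.Nat using (_+_)
open import Data.Fin using (Fin)
open import Data.List using (List; length)
open import Data.Product using (_×_)
open import Data.Rational using (ℚ; Positive; 1ℚ; _-_; _*_; 1/_; _≤_)
open import Data.Rational.Properties using (pos⇒nonZero)
import Data.Nat as ℕ

open import Data.Product using (_,_; proj₂)
open import Data.Fin.Properties using (_≟_)
open import Relation.Nullary using (Dec; no)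
open import Relation.Binary.PropositionalEquality as ≡ using (_≡_)
open import Data.Empty using (⊥)
open import Data.Nat.Properties using (+-identityʳ; ≤-reflexive)
open Counting using (count-empty; count-≟)

theorem4 : ∀ {c ℓ} (G : AbelianGroup c ℓ) (A B : List (AbelianGroup.Carrier G)) →
    IsFinSet G A → IsFinSet G B →
    (D : List (AbelianGroup.Carrier G)) → Enumerates G D (InDiff G B) →
    (ε : ℚ) → .{{_ : Positive ε}} →
    toℚ (length B) ≤ (1ℚ - ε) * toℚ (length A) →
    (1/ ε) {{pos⇒nonZero ε}} * toℚ (length A) ≤ toℚ (length D) →
    ((S : List (AbelianGroup.Carrier G)) → Enumerates G S (InSum G A B) →
      length A + length B ℕ.≤ length S)
    × ((τ : Fin (length B) → Fin (length A)) →
      (S : List (AbelianGroup.Carrier G)) → Enumerates G S (InRestrSum G A B τ) →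
      length A + length B ℕ.≤ length S + 2)
theorem4 G A B A! _ D D-enum ε B≤[1-ε]A A/ε≤D = sumset , restricted-sumset
  where
  open AbelianGroup G using (refl)
  open Density.FromHypotheses (length A) (length B) (length D) ε B≤[1-ε]A A/ε≤D using (gap; n≡m+gap; square≤N*gap)

  nothing? : (i : Fin (length A)) (j : Fin (length B)) → Dec ⊥
  nothing? _ _ = no λ ()

  sumset : (S : List (AbelianGroup.Carrier G)) → Enumerates G S (InSum G A B) → length A + length B ℕ.≤ length S
  sumset S (S! , S-enum) = ≡.subst (length A + length B ℕ.≤_) (+-identityʳ (length S))
    (Sumsets.restricted-sumset-bound G A B A! (λ _ _ → ⊥) nothing? S S!
      (λ i j _ → proj₂ (S-enum _) (i , j , refl)) D D-enum 0 gap
      (λ j → ≤-reflexive (count-empty (λ i → nothing? i j) λ _ ())) n≡m+gap square≤N*gap)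

  restricted-sumset : (τ : Fin (length B) → Fin (length A)) → (S : List (AbelianGroup.Carrier G)) →
    Enumerates G S (InRestrSum G A B τ) → length A + length B ℕ.≤ length S + 2
  restricted-sumset τ S (S! , S-enum) =
    Sumsets.restricted-sumset-bound G A B A! (λ i j → i ≡ τ j) (λ i j → i ≟ τ j) S S!
      (λ i j i≢τj → proj₂ (S-enum _) (i , j , i≢τj , refl)) D D-enum 1 gap
      (λ j → ≤-reflexive (count-≟ (τ j))) n≡m+gap square≤N*gap
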